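{- For all formulas $q_1,\dots,q_n,q\in F(V)$: if $q_1,\dots,q_n\vdash_{\mathrm{sq}Ł^*}q$, then $q_1,\dots,q_n\vDash_{\mathbb{SQW}^*}q$.
   Context: Strong quasi-Wajsberg* algebras. A quasi-Wajsberg* algebra is an algebra $\mathbf{W}=\langle W;\to,\neg,{}^+,{}^-,1\rangle$ of type $\langle 2,1,1,1,0\rangle$ such that for all $x,y,z\in W$: (QW*1) $x\to y=\neg y\to\neg x$; (QW*2) $(x\to1)\to((y\to1)\to z)=(y\to1)\to((x\to1)\to z)$; (QW*3) $(1\to x)\to1=1$; (QW*4) $(z\to z)\to(x\to y)=x\to y$; (QW*5) $(1\to1)\to x^+=((1\to1)\to x)^+=(x\to1)\to1$ and $(1\to1)\to x^-=((1\to1)\to x)^-=(x\to\neg1)\to\neg1$; (QW*6) $x\to y=(y^+\to x^-)\to(x^+\to y^-)$; (QW*7) $\neg(x\to y)=y\to x$; (QW*8) $\neg\neg x=x$; (QW*9) $(x\to(\neg x\to y))^+=x^+\to(\neg x^+\to y^+)$; (QW*10) $x\vee y=y\vee x$; (QW*11) $x\vee(y\vee z)=(x\vee y)\vee z$; (QW*12) $x\to(y\vee z)=(x\to y)\vee(x\to z)$; here $x\vee y:=((x^+\to y^+)^+\to(\neg x)^-)\to((y^-\to x^-)^-\to x^-)$. A strong quasi-Wajsberg* algebra is a quasi-Wajsberg* algebra satisfying $x^+=(1\to1)\to x^+$ and $x^-=(1\to1)\to x^-$; $\mathbb{SQW}^*$ is the variety of these. Consequence: $t_1,\dots,t_n\vDash_{\mathbb{SQW}^*}t$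 means $\mathbb{SQW}^*\models t_1\approx(c_1\to1)\to1\ \&\cdots\&\ t_n\approx(c_n\to1)\to1\Rightarrow t\approx(c\to1)\to1$, where $c_1,\dots,c_n,c$ are constants denoting designated elements; i.e. in every $\mathbf{A}\in\mathbb{SQW}^*$ under every assignment, if each $t_i$ takes a value of the form $(a_i\to1)\to1$ ($a_i\in A$), then $t$ takes a value of the form $(a\to1)\to1$ ($a\in A$). The logic $\mathrm{sq}Ł^*$: $F(V)$ is the set of formulas built from propositional variables $V$ with $\to$, $\neg$, $1$. Abbreviations: $p^+=(p\to1)\to1$, $p^-=(p\to\neg1)\to\neg1$, $p\vee q=((p^+\to q^+)^+\to(\neg p)^-)\to((q^-\to p^-)^-\to p^-)$; an axiom $p\leftrightarrow q$ stands for the two axioms $p\to q$, $q\to p$. Axioms: (Q1) $(p\to q)\leftrightarrow(\neg q\to\neg p)$; (Q2) $1\leftrightarrow((1\to p)\to1)$; (Q3) $p\leftrightarrow((q\to q)\to p)$; (Q4) $(p\to q)\leftrightarrow((q^+\to p^-)\to(p^+\to q^-))$; (Q5) $\neg(p\to q)\leftrightarrow(q\to p)$; (Q6) $(p\to(\neg p\to q))^+\leftrightarrow(p^+\to(\neg p^+\to q^+))$; (Q7) $(p\to(q\vee r))\leftrightarrow((p\to r)\vee(p\to q))$; (Q8) $(p\vee(q\vee r))\leftrightarrow((p\vee q)\vee r)$; (Q9) $((p\to1)\to((q\to1)\to r))\to((q\to1)\to((p\to1)\to r))$; (Q10) $p\to1$. Rules: (qMP) $(r\to r)\to p,\ (r\to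 r)\to(p\to q)\vdash(r\to r)\to q$; (Reg) $p\vdash(r\to r)\to p$; (AReg1) $(r\to r)\to(p\to q)\vdash p\to q$; (AReg2) $(r\to r)\to\neg(p\to q)\vdash\neg(p\to q)$; (AReg3) $(r\to r)\to\neg1\vdash\neg1$; (AReg4) $(r\to r)\to1\vdash1$; (Inv1) $p\vdash\neg\neg p$; (Inv2) $\neg\neg p\vdash p$; (Flat) $p,\neg1\vdash\neg p$; (R2$'$) $p\to q,\ r\to t\vdash(q\to r)\to(p\to t)$; (R3$'$) $(r\to r)\to p\vdash p^-$. $\Gamma\vdash_{\mathrm{sq}Ł^*}q$ means there is a finite sequence ending in $q$ each member of which is an axiom, a member of $\Gamma$, or obtained from earlier members by a rule. -}

module Defs where

open import Level using (Level; suc)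
open import Data.List using (List)
open import Data.List.Relation.Unary.All using (All)
open import Data.List.Membership.Propositional using (_∈_)
open import Data.Product using (Σ)
open import Relation.Binary.PropositionalEquality using (_≡_)

joinOp : ∀ {c} {W : Set c} → (W → W → W) → (W → W) → (W → W) → (W → W) → W → W → W
joinOp _⇒_ ¬_ _⁺ _⁻ x y =
  ((((x ⁺) ⇒ (y ⁺)) ⁺) ⇒ ((¬ x) ⁻)) ⇒ ((((y ⁻) ⇒ (x ⁻)) ⁻) ⇒ (x ⁻))

record SQW (c : Level) : Set (suc c) where
  infixr 5 _⇒_
  field
    W   : Set c
    _⇒_ : W → W → W
    ¬_  : W → W
    _⁺  : W → W
    _⁻  : W → W
    𝟙   : W

  _∨_ : W → W → W
  _∨_ = joinOp _⇒_ ¬_ _⁺ _⁻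

  field
    qw1  : ∀ x y → (x ⇒ y) ≡ ((¬ y) ⇒ (¬ x))
    qw2  : ∀ x y z → ((x ⇒ 𝟙) ⇒ ((y ⇒ 𝟙) ⇒ z)) ≡ ((y ⇒ 𝟙) ⇒ ((x ⇒ 𝟙) ⇒ z))
    qw3  : ∀ x → ((𝟙 ⇒ x) ⇒ 𝟙) ≡ 𝟙
    qw4  : ∀ x y z → ((z ⇒ z) ⇒ (x ⇒ y)) ≡ (x ⇒ y)
    qw5a : ∀ x → ((𝟙 ⇒ 𝟙) ⇒ (x ⁺)) ≡ (((𝟙 ⇒ 𝟙) ⇒ x) ⁺)
    qw5b : ∀ x → (((𝟙 ⇒ 𝟙) ⇒ x) ⁺) ≡ ((x ⇒ 𝟙) ⇒ 𝟙)
    qw5c : ∀ x → ((𝟙 ⇒ 𝟙) ⇒ (x ⁻)) ≡ (((𝟙 ⇒ 𝟙) ⇒ x) ⁻)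
    qw5d : ∀ x → (((𝟙 ⇒ 𝟙) ⇒ x) ⁻) ≡ ((x ⇒ (¬ 𝟙)) ⇒ (¬ 𝟙))
    qw6  : ∀ x y → (x ⇒ y) ≡ (((y ⁺) ⇒ (x ⁻)) ⇒ ((x ⁺) ⇒ (y ⁻)))
    qw7  : ∀ x y → (¬ (x ⇒ y)) ≡ (y ⇒ x)
    qw8  : ∀ x → (¬ (¬ x)) ≡ x
    qw9  : ∀ x y → ((x ⇒ ((¬ x) ⇒ y)) ⁺) ≡ ((x ⁺) ⇒ ((¬ (x ⁺)) ⇒ (y ⁺)))
    qw10 : ∀ x y → (x ∨ y) ≡ (y ∨ x)
    qw11 : ∀ x y z → (x ∨ (y ∨ z)) ≡ ((x ∨ y) ∨ z)
    qw12 : ∀ x y z → (x ⇒ (y ∨ z)) ≡ ((x ⇒ y) ∨ (x ⇒ z))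
    strong⁺ : ∀ x → (x ⁺) ≡ ((𝟙 ⇒ 𝟙) ⇒ (x ⁺))
    strong⁻ : ∀ x → (x ⁻) ≡ ((𝟙 ⇒ 𝟙) ⇒ (x ⁻))

infixr 5 _⇒_

data Fm (V : Set) : Set where
  var : V → Fm V
  _⇒_ : Fm V → Fm V → Fm V
  ~_  : Fm V → Fm V
  𝟏   : Fm V

module _ {V : Set} where

  _⁺ : Fm V → Fm V
  p ⁺ = (p ⇒ 𝟏) ⇒ 𝟏

  _⁻ : Fm V → Fm V
  p ⁻ = (p ⇒ (~ 𝟏)) ⇒ (~ 𝟏)

  _∨_ : Fm V → Fm V → Fm V
  p ∨ q = ((((p ⁺) ⇒ (q ⁺)) ⁺) ⇒ ((~ p) ⁻)) ⇒ ((((q ⁻) ⇒ (p ⁻)) ⁻) ⇒ (p ⁻))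

  -- axiom schemes of the form  p ↔ q  (each yields p → q and q → p)
  data BiAx : Fm V → Fm V → Set where
    Q1 : ∀ p q → BiAx (p ⇒ q) ((~ q) ⇒ (~ p))
    Q2 : ∀ p → BiAx 𝟏 ((𝟏 ⇒ p) ⇒ 𝟏)
    Q3 : ∀ p q → BiAx p ((q ⇒ q) ⇒ p)
    Q4 : ∀ p q → BiAx (p ⇒ q) (((q ⁺) ⇒ (p ⁻)) ⇒ ((p ⁺) ⇒ (q ⁻)))
    Q5 : ∀ p q → BiAx (~ (p ⇒ q)) (q ⇒ p)
    Q6 : ∀ p q → BiAx ((p ⇒ ((~ p) ⇒ q)) ⁺) ((p ⁺) ⇒ ((~ (p ⁺)) ⇒ (q ⁺)))
    Q7 : ∀ p q r → BiAx (p ⇒ (q ∨ r)) ((p ⇒ r) ∨ (p ⇒ q))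
    Q8 : ∀ p q r → BiAx (p ∨ (q ∨ r)) ((p ∨ q) ∨ r)

  data Axiom : Fm V → Set where
    bi→ : ∀ {p q} → BiAx p q → Axiom (p ⇒ q)
    bi← : ∀ {p q} → BiAx p q → Axiom (q ⇒ p)
    Q9  : ∀ p q r → Axiom (((p ⇒ 𝟏) ⇒ ((q ⇒ 𝟏) ⇒ r)) ⇒ ((q ⇒ 𝟏) ⇒ ((p ⇒ 𝟏) ⇒ r)))
    Q10 : ∀ p → Axiom (p ⇒ 𝟏)

  infix 3 _⊢_
  data _⊢_ (Γ : List (Fm V)) : Fm V → Set where
    ax    : ∀ {p} → Axiom p → Γ ⊢ p
    hyp   : ∀ {p} → p ∈ Γ → Γ ⊢ p
    qMP   : ∀ {p q r} → Γ ⊢ (r ⇒ r) ⇒ p → Γ ⊢ (r ⇒ r) ⇒ (p ⇒ q) → Γ ⊢ (r ⇒ r) ⇒ q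
    Reg   : ∀ {p r} → Γ ⊢ p → Γ ⊢ (r ⇒ r) ⇒ p
    AReg1 : ∀ {p q r} → Γ ⊢ (r ⇒ r) ⇒ (p ⇒ q) → Γ ⊢ p ⇒ q
    AReg2 : ∀ {p q r} → Γ ⊢ (r ⇒ r) ⇒ (~ (p ⇒ q)) → Γ ⊢ ~ (p ⇒ q)
    AReg3 : ∀ {r} → Γ ⊢ (r ⇒ r) ⇒ (~ 𝟏) → Γ ⊢ ~ 𝟏
    AReg4 : ∀ {r} → Γ ⊢ (r ⇒ r) ⇒ 𝟏 → Γ ⊢ 𝟏
    Inv1  : ∀ {p} → Γ ⊢ p → Γ ⊢ ~ (~ p)
    Inv2  : ∀ {p} → Γ ⊢ ~ (~ p) → Γ ⊢ p
    Flat  : ∀ {p} → Γ ⊢ p → Γ ⊢ ~ 𝟏 → Γ ⊢ ~ p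
    R2′   : ∀ {p q r t} → Γ ⊢ p ⇒ q → Γ ⊢ r ⇒ t → Γ ⊢ (q ⇒ r) ⇒ (p ⇒ t)
    R3′   : ∀ {p r} → Γ ⊢ (r ⇒ r) ⇒ p → Γ ⊢ p ⁻

module _ {c : Level} (A : SQW c) where
  open SQW A using (W; 𝟙; ¬_) renaming (_⇒_ to _⇛_)

  eval : {V : Set} → (V → W) → Fm V → W
  eval e (var v) = e v
  eval e (p ⇒ q) = eval e p ⇛ eval e q
  eval e (~ p)   = ¬ eval e p
  eval e 𝟏       = 𝟙

  Designated : W → Set c
  Designated x = Σ W (λ a → x ≡ ((a ⇛ 𝟙) ⇛ 𝟙))

_⊨[_]_ : {V : Set} → List (Fm V) → (c : Level) → Fm V → Set (suc c)
_⊨[_]_ {V} Γ c q = (A : SQW c) (e : V → SQW.W A) →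
  All (λ t → Designated A (eval A e t)) Γ → Designated A (eval A e q)

-- In a strong quasi-Wajsberg* algebra the designated elements (a → 1) → 1 are exactly the
-- fixed points of x ↦ x⁺, so it suffices to show that every derivable formula evaluates to
-- such a fixed point. Reading "x → y is positive" as an order x ≼ y, one shows that x ≼ y
-- holds precisely when x ∨ y = (1 → 1) → y; associativity of the join then makes ≼
-- transitive, and → antitone in its first and monotone in its second argument. This takes
-- care of qMP and R2′, while the two sides of every biconditional axiom turn out to have the
-- same regular part (1 → 1) → x, which already yields both implications. The one delicate
-- step is that x → y = 1 → 1 forces x and y to have the same regular part; this goes through
-- the decomposition (1 → 1) → x = ¬x⁺ → x⁻ and rests on (QW*9).
module Submission where

open import Defs renaming (_⁺ to _⁺ᶠ; _⁻ to _⁻ᶠ; _∨_ to _∨ᶠ_)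
open import Level using (Level)
open import Data.List using (List)
open import Data.List.Relation.Unary.All using (All; lookup)
open import Data.Product using (_,_)
open import Relation.Binary.PropositionalEquality

module Properties {c : Level} (A : SQW c) where
  open SQW A renaming (_⇒_ to _⇛_)
  open ≡-Reasoning

  ε : W
  ε = 𝟙 ⇛ 𝟙

  Regular : W → Set c
  Regular x = ε ⇛ x ≡ x

  Positive : W → Set c
  Positive x = x ⁺ ≡ x

  infix 4 _≼_
  _≼_ : W → W → Set c
  x ≼ y = Positive (x ⇛ y)

  ⇛-regular : ∀ x y → Regular (x ⇛ y)
  ⇛-regular x y = qw4 x y 𝟙

  ¬ε≡ε : ¬ ε ≡ ε
  ¬ε≡ε = qw7 𝟙 𝟙

  x⇛x≡ε : ∀ x → x ⇛ x ≡ ε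
  x⇛x≡ε x = begin
    x ⇛ x            ≡⟨ sym (⇛-regular x x) ⟩
    ε ⇛ (x ⇛ x)      ≡⟨ sym (qw7 (x ⇛ x) ε) ⟩
    ¬ ((x ⇛ x) ⇛ ε)  ≡⟨ cong ¬_ (qw4 𝟙 𝟙 x) ⟩
    ¬ ε              ≡⟨ ¬ε≡ε ⟩
    ε                ∎

  ⇛≡ε-sym : ∀ {x y} → x ⇛ y ≡ ε → y ⇛ x ≡ ε
  ⇛≡ε-sym {x} {y} eq = trans (sym (qw7 x y)) (trans (cong ¬_ eq) ¬ε≡ε)

  ¬⇛-regular : ∀ x y → Regular (¬ (x ⇛ y))
  ¬⇛-regular x y = trans (cong (ε ⇛_) (qw7 x y)) (trans (⇛-regular y x) (sym (qw7 x y)))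

  regular⇒⇛ε≡¬ : ∀ {x} → Regular x → x ⇛ ε ≡ ¬ x
  regular⇒⇛ε≡¬ {x} r = trans (sym (qw7 ε x)) (cong ¬_ r)

  ⁺-regular : ∀ x → Regular (x ⁺)
  ⁺-regular x = sym (strong⁺ x)

  ⁻-regular : ∀ x → Regular (x ⁻)
  ⁻-regular x = sym (strong⁻ x)

  ⁺-def : ∀ x → x ⁺ ≡ (x ⇛ 𝟙) ⇛ 𝟙
  ⁺-def x = trans (strong⁺ x) (trans (qw5a x) (qw5b x))

  ⁻-def : ∀ x → x ⁻ ≡ (x ⇛ ¬ 𝟙) ⇛ ¬ 𝟙
  ⁻-def x = trans (strong⁻ x) (trans (qw5c x) (qw5d x))

  ⁺-ε⇛ : ∀ x → (ε ⇛ x) ⁺ ≡ x ⁺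
  ⁺-ε⇛ x = trans (sym (qw5a x)) (⁺-regular x)

  ⁻-ε⇛ : ∀ x → (ε ⇛ x) ⁻ ≡ x ⁻
  ⁻-ε⇛ x = trans (sym (qw5c x)) (⁻-regular x)

  ⇛-ε⇛ʳ : ∀ x y → x ⇛ (ε ⇛ y) ≡ x ⇛ y
  ⇛-ε⇛ʳ x y = begin
    x ⇛ (ε ⇛ y)                                     ≡⟨ qw6 x (ε ⇛ y) ⟩
    ((ε ⇛ y) ⁺ ⇛ x ⁻) ⇛ (x ⁺ ⇛ (ε ⇛ y) ⁻)
      ≡⟨ cong₂ (λ u v → (u ⇛ x ⁻) ⇛ (x ⁺ ⇛ v)) (⁺-ε⇛ y) (⁻-ε⇛ y) ⟩
    (y ⁺ ⇛ x ⁻) ⇛ (x ⁺ ⇛ y ⁻)                       ≡⟨ sym (qw6 x y) ⟩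
    x ⇛ y                                           ∎

  ε⇛-⇛ˡ : ∀ x y → (ε ⇛ x) ⇛ y ≡ x ⇛ y
  ε⇛-⇛ˡ x y = begin
    (ε ⇛ x) ⇛ y                                     ≡⟨ qw6 (ε ⇛ x) y ⟩
    (y ⁺ ⇛ (ε ⇛ x) ⁻) ⇛ ((ε ⇛ x) ⁺ ⇛ y ⁻)
      ≡⟨ cong₂ (λ u v → (y ⁺ ⇛ v) ⇛ (u ⇛ y ⁻)) (⁺-ε⇛ x) (⁻-ε⇛ x) ⟩
    (y ⁺ ⇛ x ⁻) ⇛ (x ⁺ ⇛ y ⁻)                       ≡⟨ sym (qw6 x y) ⟩
    x ⇛ y                                           ∎

  𝟙-regular : Regular 𝟙
  𝟙-regular = qw3 𝟙

  𝟙⇛[𝟙⇛x]≡¬𝟙 : ∀ x → 𝟙 ⇛ (𝟙 ⇛ x) ≡ ¬ 𝟙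
  𝟙⇛[𝟙⇛x]≡¬𝟙 x = begin
    𝟙 ⇛ (𝟙 ⇛ x)          ≡⟨ sym (qw8 _) ⟩
    ¬ ¬ (𝟙 ⇛ (𝟙 ⇛ x))    ≡⟨ cong ¬_ (qw7 𝟙 (𝟙 ⇛ x)) ⟩
    ¬ ((𝟙 ⇛ x) ⇛ 𝟙)      ≡⟨ cong ¬_ (qw3 x) ⟩
    ¬ 𝟙                  ∎

  ¬𝟙≡𝟙⇛ε : ¬ 𝟙 ≡ 𝟙 ⇛ ε
  ¬𝟙≡𝟙⇛ε = sym (𝟙⇛[𝟙⇛x]≡¬𝟙 𝟙)

  𝟙⇛¬𝟙≡¬𝟙 : 𝟙 ⇛ ¬ 𝟙 ≡ ¬ 𝟙
  𝟙⇛¬𝟙≡¬𝟙 = trans (cong (𝟙 ⇛_) ¬𝟙≡𝟙⇛ε) (𝟙⇛[𝟙⇛x]≡¬𝟙 ε)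

  ¬𝟙⇛𝟙≡𝟙 : ¬ 𝟙 ⇛ 𝟙 ≡ 𝟙
  ¬𝟙⇛𝟙≡𝟙 = trans (sym (qw7 𝟙 (¬ 𝟙))) (trans (cong ¬_ 𝟙⇛¬𝟙≡¬𝟙) (qw8 𝟙))

  ¬𝟙-regular : Regular (¬ 𝟙)
  ¬𝟙-regular = trans (cong (ε ⇛_) ¬𝟙≡𝟙⇛ε) (trans (⇛-regular 𝟙 ε) (sym ¬𝟙≡𝟙⇛ε))

  ⁺≡¬𝟙⇛[𝟙⇛x] : ∀ x → x ⁺ ≡ ¬ 𝟙 ⇛ (𝟙 ⇛ x)
  ⁺≡¬𝟙⇛[𝟙⇛x] x = trans (⁺-def x) (trans (qw1 (x ⇛ 𝟙) 𝟙) (cong (¬ 𝟙 ⇛_) (qw7 x 𝟙)))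

  ⁻≡𝟙⇛[¬𝟙⇛x] : ∀ x → x ⁻ ≡ 𝟙 ⇛ (¬ 𝟙 ⇛ x)
  ⁻≡𝟙⇛[¬𝟙⇛x] x = trans (⁻-def x) (trans (qw1 (x ⇛ ¬ 𝟙) (¬ 𝟙)) (cong₂ _⇛_ (qw8 𝟙) (qw7 x (¬ 𝟙))))

  ¬-⁺ : ∀ x → ¬ (x ⁺) ≡ (¬ x) ⁻
  ¬-⁺ x = begin
    ¬ (x ⁺)              ≡⟨ cong ¬_ (⁺-def x) ⟩
    ¬ ((x ⇛ 𝟙) ⇛ 𝟙)      ≡⟨ qw7 _ _ ⟩
    𝟙 ⇛ (x ⇛ 𝟙)          ≡⟨ cong (𝟙 ⇛_) (qw1 x 𝟙) ⟩
    𝟙 ⇛ (¬ 𝟙 ⇛ ¬ x)      ≡⟨ sym (⁻≡𝟙⇛[¬𝟙⇛x] (¬ x)) ⟩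
    (¬ x) ⁻              ∎

  ¬-⁻ : ∀ x → ¬ (x ⁻) ≡ (¬ x) ⁺
  ¬-⁻ x = begin
    ¬ (x ⁻)              ≡⟨ cong ¬_ (⁻≡𝟙⇛[¬𝟙⇛x] x) ⟩
    ¬ (𝟙 ⇛ (¬ 𝟙 ⇛ x))    ≡⟨ qw7 _ _ ⟩
    (¬ 𝟙 ⇛ x) ⇛ 𝟙        ≡⟨ cong (_⇛ 𝟙) (trans (qw1 (¬ 𝟙) x) (cong (¬ x ⇛_) (qw8 𝟙))) ⟩
    (¬ x ⇛ 𝟙) ⇛ 𝟙        ≡⟨ sym (⁺-def (¬ x)) ⟩
    (¬ x) ⁺              ∎

  ⁻≡¬[¬⁺] : ∀ x → x ⁻ ≡ ¬ ((¬ x) ⁺)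
  ⁻≡¬[¬⁺] x = trans (sym (qw8 (x ⁻))) (cong ¬_ (¬-⁻ x))

  𝟙⁺≡𝟙 : 𝟙 ⁺ ≡ 𝟙
  𝟙⁺≡𝟙 = trans (⁺-def 𝟙) (qw3 𝟙)

  𝟙⁻≡ε : 𝟙 ⁻ ≡ ε
  𝟙⁻≡ε = trans (⁻-def 𝟙) (trans (cong (_⇛ ¬ 𝟙) 𝟙⇛¬𝟙≡¬𝟙) (x⇛x≡ε (¬ 𝟙)))

  ¬𝟙⁺≡ε : (¬ 𝟙) ⁺ ≡ ε
  ¬𝟙⁺≡ε = trans (⁺-def (¬ 𝟙)) (cong (_⇛ 𝟙) ¬𝟙⇛𝟙≡𝟙)

  ¬𝟙⁻≡¬𝟙 : (¬ 𝟙) ⁻ ≡ ¬ 𝟙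
  ¬𝟙⁻≡¬𝟙 = trans (sym (¬-⁺ 𝟙)) (cong ¬_ 𝟙⁺≡𝟙)

  ε⁺≡ε : ε ⁺ ≡ ε
  ε⁺≡ε = trans (⁺-def ε) (cong (_⇛ 𝟙) 𝟙-regular)

  ε⁻≡ε : ε ⁻ ≡ ε
  ε⁻≡ε = trans (⁻-def ε) (trans (cong (_⇛ ¬ 𝟙) ¬𝟙-regular) (x⇛x≡ε (¬ 𝟙)))

  ⁺-idem : ∀ x → (x ⁺) ⁺ ≡ x ⁺
  ⁺-idem x = begin
    (x ⁺) ⁺                                      ≡⟨ ⁺≡¬𝟙⇛[𝟙⇛x] (x ⁺) ⟩
    ¬ 𝟙 ⇛ (𝟙 ⇛ x ⁺)                              ≡⟨ sym (cong₂ _⇛_ ¬𝟙-regular (⇛-regular 𝟙 (x ⁺))) ⟩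
    (ε ⇛ ¬ 𝟙) ⇛ (ε ⇛ (𝟙 ⇛ x ⁺))
      ≡⟨ sym (cong₂ _⇛_ (cong₂ _⇛_ u⁺≡ε ¬𝟙⁻≡¬𝟙) (cong₂ _⇛_ ¬𝟙⁺≡ε u⁻≡𝟙⇛x⁺)) ⟩
    (u ⁺ ⇛ (¬ 𝟙) ⁻) ⇛ ((¬ 𝟙) ⁺ ⇛ u ⁻)           ≡⟨ sym (qw6 (¬ 𝟙) u) ⟩
    ¬ 𝟙 ⇛ u                                      ≡⟨ sym (⁺≡¬𝟙⇛[𝟙⇛x] x) ⟩
    x ⁺                                          ∎
    where
    u : W
    u = 𝟙 ⇛ x
    u⁺≡ε : u ⁺ ≡ ε
    u⁺≡ε = trans (⁺≡¬𝟙⇛[𝟙⇛x] u) (trans (cong (¬ 𝟙 ⇛_) (𝟙⇛[𝟙⇛x]≡¬𝟙 x)) (x⇛x≡ε (¬ 𝟙)))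
    u⁻≡𝟙⇛x⁺ : u ⁻ ≡ 𝟙 ⇛ x ⁺
    u⁻≡𝟙⇛x⁺ = trans (⁻≡𝟙⇛[¬𝟙⇛x] u) (cong (𝟙 ⇛_) (sym (⁺≡¬𝟙⇛[𝟙⇛x] x)))

  ⁻-idem : ∀ x → (x ⁻) ⁻ ≡ x ⁻
  ⁻-idem x = begin
    (x ⁻) ⁻              ≡⟨ ⁻≡¬[¬⁺] (x ⁻) ⟩
    ¬ ((¬ (x ⁻)) ⁺)      ≡⟨ cong (λ w → ¬ (w ⁺)) (¬-⁻ x) ⟩
    ¬ (((¬ x) ⁺) ⁺)      ≡⟨ cong ¬_ (⁺-idem (¬ x)) ⟩
    ¬ ((¬ x) ⁺)          ≡⟨ sym (⁻≡¬[¬⁺] x) ⟩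
    x ⁻                  ∎

  ⁺⁻≡ε : ∀ x → (x ⁺) ⁻ ≡ ε
  ⁺⁻≡ε x = trans (⁻≡𝟙⇛[¬𝟙⇛x] (x ⁺)) (cong (𝟙 ⇛_) ¬𝟙⇛x⁺≡𝟙)
    where
    ¬x⁺≡𝟙⇛[x⇛𝟙] : ¬ (x ⁺) ≡ 𝟙 ⇛ (x ⇛ 𝟙)
    ¬x⁺≡𝟙⇛[x⇛𝟙] = trans (cong ¬_ (⁺-def x)) (qw7 _ _)
    ¬𝟙⇛x⁺≡𝟙 : ¬ 𝟙 ⇛ x ⁺ ≡ 𝟙
    ¬𝟙⇛x⁺≡𝟙 = trans (qw1 _ _) (trans (cong₂ _⇛_ ¬x⁺≡𝟙⇛[x⇛𝟙] (qw8 𝟙)) (qw3 (x ⇛ 𝟙)))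

  ⁻⁺≡ε : ∀ x → (x ⁻) ⁺ ≡ ε
  ⁻⁺≡ε x = begin
    (x ⁻) ⁺              ≡⟨ sym (qw8 _) ⟩
    ¬ ¬ ((x ⁻) ⁺)        ≡⟨ cong ¬_ (¬-⁺ (x ⁻)) ⟩
    ¬ ((¬ (x ⁻)) ⁻)      ≡⟨ cong (λ w → ¬ (w ⁻)) (¬-⁻ x) ⟩
    ¬ (((¬ x) ⁺) ⁻)      ≡⟨ cong ¬_ (⁺⁻≡ε (¬ x)) ⟩
    ¬ ε                  ≡⟨ ¬ε≡ε ⟩
    ε                    ∎

  [x⇛y]⁻≡¬[y⇛x]⁺ : ∀ x y → (x ⇛ y) ⁻ ≡ ¬ ((y ⇛ x) ⁺)
  [x⇛y]⁻≡¬[y⇛x]⁺ x y = trans (⁻≡¬[¬⁺] _) (cong (λ w → ¬ (w ⁺)) (qw7 x y))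

  ⁺⇛𝟙≡⇛𝟙 : ∀ x → x ⁺ ⇛ 𝟙 ≡ x ⇛ 𝟙
  ⁺⇛𝟙≡⇛𝟙 x = trans (⇛𝟙-form (x ⁺)) (trans (cong (λ w → ¬ 𝟙 ⇛ (w ⇛ ε)) (⁺-idem x)) (sym (⇛𝟙-form x)))
    where
    ⇛𝟙-form : ∀ y → y ⇛ 𝟙 ≡ ¬ 𝟙 ⇛ (y ⁺ ⇛ ε)
    ⇛𝟙-form y = trans (qw6 y 𝟙) (cong₂ _⇛_
      (trans (cong (_⇛ y ⁻) 𝟙⁺≡𝟙) (trans (cong (𝟙 ⇛_) (⁻≡𝟙⇛[¬𝟙⇛x] y)) (𝟙⇛[𝟙⇛x]≡¬𝟙 (¬ 𝟙 ⇛ y))))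
      (cong (y ⁺ ⇛_) 𝟙⁻≡ε))

  ε⇛≡¬⁺⇛⁻ : ∀ x → ε ⇛ x ≡ ¬ (x ⁺) ⇛ x ⁻
  ε⇛≡¬⁺⇛⁻ x = begin
    ε ⇛ x                            ≡⟨ qw6 ε x ⟩
    (x ⁺ ⇛ ε ⁻) ⇛ (ε ⁺ ⇛ x ⁻)        ≡⟨ cong₂ (λ u v → (x ⁺ ⇛ u) ⇛ (v ⇛ x ⁻)) ε⁻≡ε ε⁺≡ε ⟩
    (x ⁺ ⇛ ε) ⇛ (ε ⇛ x ⁻)            ≡⟨ cong₂ _⇛_ (regular⇒⇛ε≡¬ (⁺-regular x)) (⁻-regular x) ⟩
    ¬ (x ⁺) ⇛ x ⁻                    ∎

  regular⇒≡ε : ∀ {x} → Regular x → x ⁺ ≡ ε → x ⁻ ≡ ε → x ≡ ε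
  regular⇒≡ε {x} r x⁺≡ε x⁻≡ε = begin
    x                ≡⟨ sym r ⟩
    ε ⇛ x            ≡⟨ ε⇛≡¬⁺⇛⁻ x ⟩
    ¬ (x ⁺) ⇛ x ⁻    ≡⟨ cong₂ _⇛_ (trans (cong ¬_ x⁺≡ε) ¬ε≡ε) x⁻≡ε ⟩
    ε ⇛ ε            ≡⟨ x⇛x≡ε ε ⟩
    ε                ∎

  ⇛≡ε-intro : ∀ {x y} → (x ⇛ y) ⁺ ≡ ε → (y ⇛ x) ⁺ ≡ ε → x ⇛ y ≡ ε
  ⇛≡ε-intro {x} {y} p q =
    regular⇒≡ε (⇛-regular x y) p (trans ([x⇛y]⁻≡¬[y⇛x]⁺ x y) (trans (cong ¬_ q) ¬ε≡ε))

  designated⇒positive : ∀ {x} → Designated A x → Positive x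
  designated⇒positive {x} (a , x≡a⁺) = begin
    x ⁺        ≡⟨ cong _⁺ (trans x≡a⁺ (sym (⁺-def a))) ⟩
    (a ⁺) ⁺    ≡⟨ ⁺-idem a ⟩
    a ⁺        ≡⟨ trans (⁺-def a) (sym x≡a⁺) ⟩
    x          ∎

  positive⇒designated : ∀ {x} → Positive x → Designated A x
  positive⇒designated {x} p = x , trans (sym p) (⁺-def x)

  positive⇒⁻≡ε : ∀ {x} → Positive x → x ⁻ ≡ ε
  positive⇒⁻≡ε {x} p = trans (cong _⁻ (sym p)) (⁺⁻≡ε x)

  positive⇒regular : ∀ {x} → Positive x → Regular x
  positive⇒regular {x} p = trans (cong (ε ⇛_) (sym p)) (trans (⁺-regular x) p)

  ≡ε⇒positive : ∀ {x} → x ≡ ε → Positive x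
  ≡ε⇒positive refl = ε⁺≡ε

  ∨-ε : ∀ x → x ∨ ε ≡ x ⁺
  ∨-ε x = begin
    (((x ⁺ ⇛ ε ⁺) ⁺) ⇛ (¬ x) ⁻) ⇛ (((ε ⁻ ⇛ x ⁻) ⁻) ⇛ x ⁻)
      ≡⟨ cong₂ _⇛_ (cong₂ _⇛_ left (sym (¬-⁺ x))) right ⟩
    (ε ⇛ ¬ (x ⁺)) ⇛ ε                                       ≡⟨ cong (_⇛ ε) ¬x⁺-regular ⟩
    ¬ (x ⁺) ⇛ ε                                             ≡⟨ regular⇒⇛ε≡¬ ¬x⁺-regular ⟩
    ¬ ¬ (x ⁺)                                               ≡⟨ qw8 _ ⟩
    x ⁺                                                     ∎
    where
    ¬x⁺-regular : Regular (¬ (x ⁺))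
    ¬x⁺-regular = subst (λ w → Regular (¬ w)) (sym (⁺-def x)) (¬⇛-regular (x ⇛ 𝟙) 𝟙)
    left : (x ⁺ ⇛ ε ⁺) ⁺ ≡ ε
    left = begin
      (x ⁺ ⇛ ε ⁺) ⁺    ≡⟨ cong (λ w → (x ⁺ ⇛ w) ⁺) ε⁺≡ε ⟩
      (x ⁺ ⇛ ε) ⁺      ≡⟨ cong _⁺ (regular⇒⇛ε≡¬ (⁺-regular x)) ⟩
      (¬ (x ⁺)) ⁺      ≡⟨ sym (¬-⁻ (x ⁺)) ⟩
      ¬ ((x ⁺) ⁻)      ≡⟨ cong ¬_ (⁺⁻≡ε x) ⟩
      ¬ ε              ≡⟨ ¬ε≡ε ⟩
      ε                ∎
    right : (ε ⁻ ⇛ x ⁻) ⁻ ⇛ x ⁻ ≡ ε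
    right = begin
      (ε ⁻ ⇛ x ⁻) ⁻ ⇛ x ⁻    ≡⟨ cong (λ w → (w ⇛ x ⁻) ⁻ ⇛ x ⁻) ε⁻≡ε ⟩
      (ε ⇛ x ⁻) ⁻ ⇛ x ⁻      ≡⟨ cong (λ w → w ⁻ ⇛ x ⁻) (⁻-regular x) ⟩
      (x ⁻) ⁻ ⇛ x ⁻          ≡⟨ cong (_⇛ x ⁻) (⁻-idem x) ⟩
      x ⁻ ⇛ x ⁻              ≡⟨ x⇛x≡ε (x ⁻) ⟩
      ε                      ∎

  ε-∨ : ∀ x → ε ∨ x ≡ x ⁺
  ε-∨ x = trans (qw10 ε x) (∨-ε x)

  ∨-ε⇛ʳ : ∀ x y → x ∨ (ε ⇛ y) ≡ x ∨ y
  ∨-ε⇛ʳ x y = cong₂ (λ u v → (((x ⁺ ⇛ u) ⁺) ⇛ (¬ x) ⁻) ⇛ (((v ⇛ x ⁻) ⁻) ⇛ x ⁻)) (⁺-ε⇛ y) (⁻-ε⇛ y)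

  ∨-ε⇛ˡ : ∀ x y → (ε ⇛ x) ∨ y ≡ x ∨ y
  ∨-ε⇛ˡ x y = trans (qw10 _ _) (trans (∨-ε⇛ʳ y x) (qw10 y x))

  ∨-positiveˡ : ∀ {x} y → Positive x → Positive (x ∨ y)
  ∨-positiveˡ {x} y p = begin
    (x ∨ y) ⁺          ≡⟨ sym (∨-ε _) ⟩
    (x ∨ y) ∨ ε        ≡⟨ sym (qw11 x y ε) ⟩
    x ∨ (y ∨ ε)        ≡⟨ cong (x ∨_) (qw10 y ε) ⟩
    x ∨ (ε ∨ y)        ≡⟨ qw11 x ε y ⟩
    (x ∨ ε) ∨ y        ≡⟨ cong (_∨ y) (trans (∨-ε x) p) ⟩
    x ∨ y              ∎

  ∨-⁺≡ε : ∀ {x y} → x ⁺ ≡ ε → y ⁺ ≡ ε → (x ∨ y) ⁺ ≡ ε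
  ∨-⁺≡ε {x} {y} x⁺≡ε y⁺≡ε = begin
    (x ∨ y) ⁺          ≡⟨ sym (∨-ε _) ⟩
    (x ∨ y) ∨ ε        ≡⟨ sym (qw11 x y ε) ⟩
    x ∨ (y ∨ ε)        ≡⟨ cong (x ∨_) (trans (∨-ε y) y⁺≡ε) ⟩
    x ∨ ε              ≡⟨ ∨-ε x ⟩
    x ⁺                ≡⟨ x⁺≡ε ⟩
    ε                  ∎

  ¬-injective : ∀ {x y} → ¬ x ≡ ¬ y → x ≡ y
  ¬-injective {x} {y} eq = trans (sym (qw8 x)) (trans (cong ¬_ eq) (qw8 y))

  positive⇒¬⁺≡ε : ∀ {x} → Positive x → (¬ x) ⁺ ≡ ε
  positive⇒¬⁺≡ε {x} p = trans (sym (¬-⁻ x)) (trans (cong ¬_ (positive⇒⁻≡ε p)) ¬ε≡ε)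

  ≼-contra : ∀ {x y} → x ≼ y → ¬ y ≼ ¬ x
  ≼-contra {x} {y} = subst Positive (qw1 x y)

  ⇛⁺≡[⇛]∨[⇛ε] : ∀ x y → x ⇛ y ⁺ ≡ (x ⇛ y) ∨ (x ⇛ ε)
  ⇛⁺≡[⇛]∨[⇛ε] x y = trans (cong (x ⇛_) (sym (∨-ε y))) (qw12 x y ε)

  ≼⇒⁺-reversed : ∀ {x y} → x ≼ y → (y ⁺ ⇛ x ⁺) ⁺ ≡ ε
  ≼⇒⁺-reversed {x} {y} x≼y = trans (cong _⁺ (⇛⁺≡[⇛]∨[⇛ε] (y ⁺) x)) (∨-⁺≡ε y⁺⇛x y⁺⇛ε)
    where
    x≼y⁺ : x ≼ y ⁺
    x≼y⁺ = subst Positive (sym (⇛⁺≡[⇛]∨[⇛ε] x y)) (∨-positiveˡ (x ⇛ ε) x≼y)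
    y⁺⇛x : (y ⁺ ⇛ x) ⁺ ≡ ε
    y⁺⇛x = trans (cong _⁺ (sym (qw7 x (y ⁺)))) (positive⇒¬⁺≡ε x≼y⁺)
    y⁺⇛ε : (y ⁺ ⇛ ε) ⁺ ≡ ε
    y⁺⇛ε = trans (cong _⁺ (regular⇒⇛ε≡¬ (⁺-regular y))) (positive⇒¬⁺≡ε (⁺-idem y))

  ≼⇒⁻-reversed : ∀ {x y} → x ≼ y → (y ⁻ ⇛ x ⁻) ⁺ ≡ ε
  ≼⇒⁻-reversed {x} {y} x≼y = trans (cong _⁺ y⁻⇛x⁻≡¬x⁺⇛¬y⁺) (≼⇒⁺-reversed (≼-contra x≼y))
    where
    y⁻⇛x⁻≡¬x⁺⇛¬y⁺ : y ⁻ ⇛ x ⁻ ≡ (¬ x) ⁺ ⇛ (¬ y) ⁺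
    y⁻⇛x⁻≡¬x⁺⇛¬y⁺ = trans (qw1 (y ⁻) (x ⁻)) (cong₂ _⇛_ (¬-⁻ x) (¬-⁻ y))

  ⁻-cong-⇛≡ε : ∀ {x y} → x ⁺ ≡ ε → y ⇛ x ≡ ε → x ⁻ ≡ y ⁻
  ⁻-cong-⇛≡ε {x} {y} x⁺≡ε y⇛x≡ε = ¬-injective (begin
    ¬ (x ⁻)                      ≡⟨ cong ¬_ (sym (⁻-ε⇛ x)) ⟩
    ¬ ((ε ⇛ x) ⁻)                ≡⟨ ¬-⁻ _ ⟩
    (¬ (ε ⇛ x)) ⁺                ≡⟨ cong _⁺ (qw7 ε x) ⟩
    (x ⇛ ε) ⁺                    ≡⟨ cong (λ w → (x ⇛ w) ⁺) (trans (sym y⇛x≡ε) (qw1 y x)) ⟩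
    (x ⇛ (¬ x ⇛ ¬ y)) ⁺          ≡⟨ qw9 x (¬ y) ⟩
    x ⁺ ⇛ (¬ (x ⁺) ⇛ (¬ y) ⁺)    ≡⟨ cong (λ w → w ⇛ (¬ w ⇛ (¬ y) ⁺)) x⁺≡ε ⟩
    ε ⇛ (¬ ε ⇛ (¬ y) ⁺)          ≡⟨ cong (λ w → ε ⇛ (w ⇛ (¬ y) ⁺)) ¬ε≡ε ⟩
    ε ⇛ (ε ⇛ (¬ y) ⁺)            ≡⟨ cong (ε ⇛_) (⁺-regular (¬ y)) ⟩
    ε ⇛ (¬ y) ⁺                  ≡⟨ ⁺-regular (¬ y) ⟩
    (¬ y) ⁺                      ≡⟨ sym (¬-⁻ y) ⟩
    ¬ (y ⁻)                      ∎)

  ⁺-cong-⇛≡ε : ∀ {x y} → x ⁻ ≡ ε → y ⇛ x ≡ ε → x ⁺ ≡ y ⁺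
  ⁺-cong-⇛≡ε {x} {y} x⁻≡ε y⇛x≡ε = ¬-injective (begin
    ¬ (x ⁺)      ≡⟨ ¬-⁺ x ⟩
    (¬ x) ⁻      ≡⟨ ⁻-cong-⇛≡ε ¬x⁺≡ε ¬y⇛¬x≡ε ⟩
    (¬ y) ⁻      ≡⟨ sym (¬-⁺ y) ⟩
    ¬ (y ⁺)      ∎)
    where
    ¬x⁺≡ε : (¬ x) ⁺ ≡ ε
    ¬x⁺≡ε = trans (sym (¬-⁻ x)) (trans (cong ¬_ x⁻≡ε) ¬ε≡ε)
    ¬y⇛¬x≡ε : ¬ y ⇛ ¬ x ≡ ε
    ¬y⇛¬x≡ε = trans (sym (qw1 x y)) (⇛≡ε-sym y⇛x≡ε)

  ε⇛-cong-⇛≡ε : ∀ {x y} → x ⇛ y ≡ ε → ε ⇛ x ≡ ε ⇛ y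
  ε⇛-cong-⇛≡ε {x} {y} x⇛y≡ε = begin
    ε ⇛ x            ≡⟨ ε⇛≡¬⁺⇛⁻ x ⟩
    ¬ (x ⁺) ⇛ x ⁻    ≡⟨ cong₂ (λ u v → ¬ u ⇛ v) x⁺≡y⁺ x⁻≡y⁻ ⟩
    ¬ (y ⁺) ⇛ y ⁻    ≡⟨ sym (ε⇛≡¬⁺⇛⁻ y) ⟩
    ε ⇛ y            ∎
    where
    x≼y : x ≼ y
    x≼y = ≡ε⇒positive x⇛y≡ε
    y≼x : y ≼ x
    y≼x = ≡ε⇒positive (⇛≡ε-sym x⇛y≡ε)
    x⁺≡y⁺ : x ⁺ ≡ y ⁺
    x⁺≡y⁺ = begin
      x ⁺        ≡⟨ sym (⁺-idem x) ⟩
      (x ⁺) ⁺    ≡⟨ ⁺-cong-⇛≡ε (⁺⁻≡ε x) (⇛≡ε-intro (≼⇒⁺-reversed x≼y) (≼⇒⁺-reversed y≼x)) ⟩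
      (y ⁺) ⁺    ≡⟨ ⁺-idem y ⟩
      y ⁺        ∎
    x⁻≡y⁻ : x ⁻ ≡ y ⁻
    x⁻≡y⁻ = begin
      x ⁻        ≡⟨ sym (⁻-idem x) ⟩
      (x ⁻) ⁻    ≡⟨ ⁻-cong-⇛≡ε (⁻⁺≡ε x) (⇛≡ε-intro (≼⇒⁻-reversed x≼y) (≼⇒⁻-reversed y≼x)) ⟩
      (y ⁻) ⁻    ≡⟨ ⁻-idem y ⟩
      y ⁻        ∎

  ≼⇒∨≡ε⇛ : ∀ {x y} → x ≼ y → x ∨ y ≡ ε ⇛ y
  ≼⇒∨≡ε⇛ {x} {y} x≼y = sym (trans (ε⇛-cong-⇛≡ε y⇛x∨y≡ε) (⇛-regular _ _))
    where
    y⇛x∨y≡ε : y ⇛ (x ∨ y) ≡ ε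
    y⇛x∨y≡ε = begin
      y ⇛ (x ∨ y)          ≡⟨ qw12 y x y ⟩
      (y ⇛ x) ∨ (y ⇛ y)    ≡⟨ cong ((y ⇛ x) ∨_) (x⇛x≡ε y) ⟩
      (y ⇛ x) ∨ ε          ≡⟨ ∨-ε _ ⟩
      (y ⇛ x) ⁺            ≡⟨ cong _⁺ (sym (qw7 x y)) ⟩
      (¬ (x ⇛ y)) ⁺        ≡⟨ positive⇒¬⁺≡ε x≼y ⟩
      ε                    ∎

  ∨≡ε⇛⇒≼ : ∀ {x y} → x ∨ y ≡ ε ⇛ y → x ≼ y
  ∨≡ε⇛⇒≼ {x} {y} eq = sym (begin
    x ⇛ y                ≡⟨ sym (⇛-ε⇛ʳ x y) ⟩
    x ⇛ (ε ⇛ y)          ≡⟨ cong (x ⇛_) (sym eq) ⟩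
    x ⇛ (x ∨ y)          ≡⟨ qw12 x x y ⟩
    (x ⇛ x) ∨ (x ⇛ y)    ≡⟨ cong (_∨ (x ⇛ y)) (x⇛x≡ε x) ⟩
    ε ∨ (x ⇛ y)          ≡⟨ ε-∨ _ ⟩
    (x ⇛ y) ⁺            ∎)

  ≼-trans : ∀ {x y z} → x ≼ y → y ≼ z → x ≼ z
  ≼-trans {x} {y} {z} x≼y y≼z = ∨≡ε⇛⇒≼ (begin
    x ∨ z                ≡⟨ sym (∨-ε⇛ʳ x z) ⟩
    x ∨ (ε ⇛ z)          ≡⟨ cong (x ∨_) (sym (≼⇒∨≡ε⇛ y≼z)) ⟩
    x ∨ (y ∨ z)          ≡⟨ qw11 x y z ⟩
    (x ∨ y) ∨ z          ≡⟨ cong (_∨ z) (≼⇒∨≡ε⇛ x≼y) ⟩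
    (ε ⇛ y) ∨ z          ≡⟨ ∨-ε⇛ˡ y z ⟩
    y ∨ z                ≡⟨ ≼⇒∨≡ε⇛ y≼z ⟩
    ε ⇛ z                ∎)

  ⇛-monoʳ-≼ : ∀ x {y z} → y ≼ z → x ⇛ y ≼ x ⇛ z
  ⇛-monoʳ-≼ x {y} {z} y≼z = ∨≡ε⇛⇒≼ (begin
    (x ⇛ y) ∨ (x ⇛ z)    ≡⟨ sym (qw12 x y z) ⟩
    x ⇛ (y ∨ z)          ≡⟨ cong (x ⇛_) (≼⇒∨≡ε⇛ y≼z) ⟩
    x ⇛ (ε ⇛ z)          ≡⟨ ⇛-ε⇛ʳ x z ⟩
    x ⇛ z                ≡⟨ sym (⇛-regular x z) ⟩
    ε ⇛ (x ⇛ z)          ∎)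

  ⇛-antiˡ-≼ : ∀ z {x y} → x ≼ y → y ⇛ z ≼ x ⇛ z
  ⇛-antiˡ-≼ z {x} {y} x≼y =
    subst₂ _≼_ (sym (qw1 y z)) (sym (qw1 x z)) (⇛-monoʳ-≼ (¬ z) (≼-contra x≼y))

  ⇛-mono-≼ : ∀ {x y z w} → x ≼ y → z ≼ w → y ⇛ z ≼ x ⇛ w
  ⇛-mono-≼ {x} {y} {z} {w} x≼y z≼w = ≼-trans (⇛-monoʳ-≼ y z≼w) (⇛-antiˡ-≼ w x≼y)

  ε⇛≡⇒≼ : ∀ {x y} → ε ⇛ x ≡ ε ⇛ y → x ≼ y
  ε⇛≡⇒≼ {x} {y} eq = ≡ε⇒positive (begin
    x ⇛ y          ≡⟨ sym (ε⇛-⇛ˡ x y) ⟩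
    (ε ⇛ x) ⇛ y    ≡⟨ cong (_⇛ y) eq ⟩
    (ε ⇛ y) ⇛ y    ≡⟨ ε⇛-⇛ˡ y y ⟩
    y ⇛ y          ≡⟨ x⇛x≡ε y ⟩
    ε              ∎)

  [z⇛z]≼⇒ε≼ : ∀ z {x} → z ⇛ z ≼ x → ε ≼ x
  [z⇛z]≼⇒ε≼ z {x} = subst (_≼ x) (x⇛x≡ε z)

  ε≼⇒[z⇛z]≼ : ∀ z {x} → ε ≼ x → z ⇛ z ≼ x
  ε≼⇒[z⇛z]≼ z {x} = subst (_≼ x) (sym (x⇛x≡ε z))

  positive⇒ε≼ : ∀ {x} → Positive x → ε ≼ x
  positive⇒ε≼ p = subst Positive (sym (positive⇒regular p)) p

  regular-ε≼⇒positive : ∀ {x} → Regular x → ε ≼ x → Positive x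
  regular-ε≼⇒positive r = subst Positive r

  ε≼⇒⁻-positive : ∀ {x} → ε ≼ x → Positive (x ⁻)
  ε≼⇒⁻-positive {x} ε≼x = ≡ε⇒positive (trans (sym (⁻-ε⇛ x)) (positive⇒⁻≡ε ε≼x))

  ⇛𝟙-positive : ∀ x → Positive (x ⇛ 𝟙)
  ⇛𝟙-positive x = begin
    (x ⇛ 𝟙) ⁺            ≡⟨ ⁺-def _ ⟩
    ((x ⇛ 𝟙) ⇛ 𝟙) ⇛ 𝟙    ≡⟨ cong (_⇛ 𝟙) (sym (⁺-def x)) ⟩
    x ⁺ ⇛ 𝟙              ≡⟨ ⁺⇛𝟙≡⇛𝟙 x ⟩
    x ⇛ 𝟙                ∎

  -- A positive ¬ 1 collapses 1, ¬ 1 and 1 → 1, hence ⁺ and ⁻ coincide.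
  ¬𝟙-positive⇒¬-positive : ∀ {x} → Positive (¬ 𝟙) → Positive x → Positive (¬ x)
  ¬𝟙-positive⇒¬-positive {x} ¬𝟙⁺≡¬𝟙 x⁺≡x = begin
    (¬ x) ⁺    ≡⟨ sym (¬-⁻ x) ⟩
    ¬ (x ⁻)    ≡⟨ cong ¬_ x⁻≡x⁺ ⟩
    ¬ (x ⁺)    ≡⟨ cong ¬_ x⁺≡x ⟩
    ¬ x        ∎
    where
    ¬𝟙≡ε : ¬ 𝟙 ≡ ε
    ¬𝟙≡ε = trans (sym ¬𝟙⁺≡¬𝟙) ¬𝟙⁺≡ε
    ¬𝟙≡𝟙 : ¬ 𝟙 ≡ 𝟙
    ¬𝟙≡𝟙 = trans ¬𝟙≡ε (sym (¬-injective (trans ¬𝟙≡ε (sym ¬ε≡ε))))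
    x⁻≡x⁺ : x ⁻ ≡ x ⁺
    x⁻≡x⁺ = trans (⁻-def x) (trans (cong (λ w → (x ⇛ w) ⇛ w) ¬𝟙≡𝟙) (sym (⁺-def x)))

module Soundness {c : Level} (A : SQW c) {V : Set} (e : V → SQW.W A) where
  open SQW A renaming (_⇒_ to _⇛_)
  open Properties A

  ⟦_⟧ : Fm V → W
  ⟦ p ⟧ = eval A e p

  ⟦⁺⟧ : ∀ p → ⟦ p ⁺ᶠ ⟧ ≡ ⟦ p ⟧ ⁺
  ⟦⁺⟧ p = sym (⁺-def ⟦ p ⟧)

  ⟦⁻⟧ : ∀ p → ⟦ p ⁻ᶠ ⟧ ≡ ⟦ p ⟧ ⁻
  ⟦⁻⟧ p = sym (⁻-def ⟦ p ⟧)

  ⟦∨⟧ : ∀ p q → ⟦ p ∨ᶠ q ⟧ ≡ ⟦ p ⟧ ∨ ⟦ q ⟧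
  ⟦∨⟧ p q = cong₂ _⇛_
    (cong₂ _⇛_ (trans (⟦⁺⟧ (p ⁺ᶠ ⇒ q ⁺ᶠ)) (cong _⁺ (cong₂ _⇛_ (⟦⁺⟧ p) (⟦⁺⟧ q)))) (⟦⁻⟧ (~ p)))
    (cong₂ _⇛_ (trans (⟦⁻⟧ (q ⁻ᶠ ⇒ p ⁻ᶠ)) (cong _⁻ (cong₂ _⇛_ (⟦⁻⟧ q) (⟦⁻⟧ p)))) (⟦⁻⟧ p))

  ⟦biAx⟧ : ∀ {p q} → BiAx p q → ε ⇛ ⟦ p ⟧ ≡ ε ⇛ ⟦ q ⟧
  ⟦biAx⟧ (Q1 p q) = cong (ε ⇛_) (qw1 ⟦ p ⟧ ⟦ q ⟧)
  ⟦biAx⟧ (Q2 p) = cong (ε ⇛_) (sym (qw3 ⟦ p ⟧))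
  ⟦biAx⟧ (Q3 p q) = sym (trans (⇛-regular _ _) (cong (_⇛ ⟦ p ⟧) (x⇛x≡ε ⟦ q ⟧)))
  ⟦biAx⟧ (Q4 p q) = cong (ε ⇛_) (trans (qw6 ⟦ p ⟧ ⟦ q ⟧)
    (sym (cong₂ _⇛_ (cong₂ _⇛_ (⟦⁺⟧ q) (⟦⁻⟧ p)) (cong₂ _⇛_ (⟦⁺⟧ p) (⟦⁻⟧ q)))))
  ⟦biAx⟧ (Q5 p q) = cong (ε ⇛_) (qw7 ⟦ p ⟧ ⟦ q ⟧)
  ⟦biAx⟧ (Q6 p q) = cong (ε ⇛_) (trans (⟦⁺⟧ (p ⇒ (~ p ⇒ q))) (trans (qw9 ⟦ p ⟧ ⟦ q ⟧)
    (sym (cong₂ _⇛_ (⟦⁺⟧ p) (cong₂ _⇛_ (cong ¬_ (⟦⁺⟧ p)) (⟦⁺⟧ q))))))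
  ⟦biAx⟧ (Q7 p q r) = cong (ε ⇛_) (trans (cong (⟦ p ⟧ ⇛_) (⟦∨⟧ q r)) (trans (qw12 ⟦ p ⟧ ⟦ q ⟧ ⟦ r ⟧)
    (trans (qw10 _ _) (sym (⟦∨⟧ (p ⇒ r) (p ⇒ q))))))
  ⟦biAx⟧ (Q8 p q r) = cong (ε ⇛_) (trans (trans (⟦∨⟧ p (q ∨ᶠ r)) (cong (⟦ p ⟧ ∨_) (⟦∨⟧ q r)))
    (trans (qw11 ⟦ p ⟧ ⟦ q ⟧ ⟦ r ⟧) (sym (trans (⟦∨⟧ (p ∨ᶠ q) r) (cong (_∨ ⟦ r ⟧) (⟦∨⟧ p q))))))

  ⟦axiom⟧ : ∀ {p} → Axiom p → Positive ⟦ p ⟧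
  ⟦axiom⟧ (bi→ b) = ε⇛≡⇒≼ (⟦biAx⟧ b)
  ⟦axiom⟧ (bi← b) = ε⇛≡⇒≼ (sym (⟦biAx⟧ b))
  ⟦axiom⟧ (Q9 p q r) = ε⇛≡⇒≼ (cong (ε ⇛_) (qw2 ⟦ p ⟧ ⟦ q ⟧ ⟦ r ⟧))
  ⟦axiom⟧ (Q10 p) = ⇛𝟙-positive ⟦ p ⟧

  sound : ∀ {Γ q} → All (λ t → Designated A ⟦ t ⟧) Γ → Γ ⊢ q → Positive ⟦ q ⟧
  sound Γ⊨ (ax a) = ⟦axiom⟧ a
  sound Γ⊨ (hyp t∈Γ) = designated⇒positive (lookup Γ⊨ t∈Γ)
  sound Γ⊨ (qMP {p} {q} {r} d₁ d₂) = ε≼⇒[z⇛z]≼ ⟦ r ⟧ (≼-trans ([z⇛z]≼⇒ε≼ ⟦ r ⟧ (sound Γ⊨ d₁))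
    (regular-ε≼⇒positive (⇛-regular ⟦ p ⟧ ⟦ q ⟧) ([z⇛z]≼⇒ε≼ ⟦ r ⟧ (sound Γ⊨ d₂))))
  sound Γ⊨ (Reg {r = r} d) = ε≼⇒[z⇛z]≼ ⟦ r ⟧ (positive⇒ε≼ (sound Γ⊨ d))
  sound Γ⊨ (AReg1 {p} {q} {r} d) =
    regular-ε≼⇒positive (⇛-regular ⟦ p ⟧ ⟦ q ⟧) ([z⇛z]≼⇒ε≼ ⟦ r ⟧ (sound Γ⊨ d))
  sound Γ⊨ (AReg2 {p} {q} {r} d) =
    regular-ε≼⇒positive (¬⇛-regular ⟦ p ⟧ ⟦ q ⟧) ([z⇛z]≼⇒ε≼ ⟦ r ⟧ (sound Γ⊨ d))
  sound Γ⊨ (AReg3 {r} d) = regular-ε≼⇒positive ¬𝟙-regular ([z⇛z]≼⇒ε≼ ⟦ r ⟧ (sound Γ⊨ d))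
  sound Γ⊨ (AReg4 {r} d) = regular-ε≼⇒positive 𝟙-regular ([z⇛z]≼⇒ε≼ ⟦ r ⟧ (sound Γ⊨ d))
  sound Γ⊨ (Inv1 d) = subst Positive (sym (qw8 _)) (sound Γ⊨ d)
  sound Γ⊨ (Inv2 d) = subst Positive (qw8 _) (sound Γ⊨ d)
  sound Γ⊨ (Flat d₁ d₂) = ¬𝟙-positive⇒¬-positive (sound Γ⊨ d₂) (sound Γ⊨ d₁)
  sound Γ⊨ (R2′ d₁ d₂) = ⇛-mono-≼ (sound Γ⊨ d₁) (sound Γ⊨ d₂)
  sound Γ⊨ (R3′ {p} {r} d) =
    subst Positive (sym (⟦⁻⟧ p)) (ε≼⇒⁻-positive ([z⇛z]≼⇒ε≼ ⟦ r ⟧ (sound Γ⊨ d)))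

theorem4p2 : ∀ {c : Level} {V : Set} (Γ : List (Fm V)) (q : Fm V) →
    Γ ⊢ q → Γ ⊨[ c ] q
theorem4p2 Γ q Γ⊢q A e Γ⊨ = Properties.positive⇒designated A (Soundness.sound A e Γ⊨ Γ⊢q)
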